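{- Let $n\ge 2$ be an integer and let $(W_r)_{r\in\mathbb{Z}}$ be any generalized $n$-step Fibonacci sequence. Then for every integer $r$ and every nonnegative integer $k$, \[ \sum_{j=0}^{k}2^{k-j}W_{r-k-n-1+j}=2^{k+1}W_{r-k-1}-W_r, \] \[ 2\sum_{j=0}^{k}(-1)^jW_{r-nk-k-1+(n+1)j}=(-1)^kW_r+W_{r-(k+1)(n+1)}, \] and \[ \sum_{j=0}^{k}2^jW_{r-nk+1+nj}=2^{k+1}W_r-W_{r-(k+1)n}. \]
   Context: A generalized $n$-step Fibonacci sequence is any sequence $(W_r)_{r\in\mathbb{Z}}$ of complex numbers satisfying $W_r=\sum_{i=1}^{n}W_{r-i}$ for all $r\in\mathbb{Z}$. -}

module Defs where

open import Level using (Level)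
open import Algebra.Bundles using (CommutativeRing)
open import Data.Nat using (ℕ; zero; suc)
open import Data.Integer using (ℤ; +_) renaming (_-_ to _-ℤ_)

module _ {c ℓ : Level} (R : CommutativeRing c ℓ) where
  open CommutativeRing R

  sum< : ℕ → (ℕ → Carrier) → Carrier
  sum< zero    f = 0#
  sum< (suc m) f = sum< m f + f m

  pow : Carrier → ℕ → Carrier
  pow x zero    = 1#
  pow x (suc m) = pow x m * x

  two : Carrier
  two = 1# + 1#

  IsGenFib : ℕ → (ℤ → Carrier) → Set ℓ
  IsGenFib n W = ∀ (r : ℤ) → W r ≈ sum< n (λ i → W (r -ℤ + suc i))

{-# OPTIONS --safe #-}
-- The defining sums of W (m + 1) and W m share the terms W (m - 1), ..., W (m - n + 1),
-- so every generalized n-step Fibonacci sequence satisfies W (m + 1) + W (m - n) = 2 W m.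
-- Weighted by 2^(k-j), (-1)^j or 2^j along a suitable arithmetic progression of indices,
-- this relation makes each of the three sums telescope.
module Submission where

open import Defs
open import Algebra.Bundles using (CommutativeRing)
open import Data.Nat using (ℕ; suc; _≤_)
open import Data.Product using (_×_)
open import Data.Integer using (ℤ; +_) renaming (_+_ to _+ℤ_; _-_ to _-ℤ_; _*_ to _*ℤ_)

open import Level using (Level)
open import Data.Nat using (zero; s≤s; _<_; _∸_)
open import Data.Nat.Properties using (+-∸-assoc; ≤-refl; m≤n⇒m≤1+n; n∸n≡0)
open import Data.Product using (_,_)
open import Data.Integer.Properties using (pos-+)
open import Data.Integer.Tactic.RingSolver using (solve-∀)
open import Relation.Binary.PropositionalEquality as Eq using (_≡_; cong; cong₂)
  renaming (sym to ≡-sym)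
import Algebra.Properties.Ring as RingProperties
import Relation.Binary.Reasoning.Setoid as SetoidReasoning

module _ {ℓ₁ ℓ₂ : Level} (R : CommutativeRing ℓ₁ ℓ₂) where
  open CommutativeRing R
  open RingProperties ring using (-‿distribˡ-*; -1*x≈-x; //-rightDividesʳ; xyx⁻¹≈y; -‿involutive)
  open import Algebra.Properties.CommutativeSemigroup *-commutativeSemigroup using (x∙yz≈yx∙z)
  open SetoidReasoning setoid

  sum<-cong : ∀ m {f g : ℕ → Carrier} → (∀ i → f i ≈ g i) → sum< R m f ≈ sum< R m g
  sum<-cong zero    f≈g = refl
  sum<-cong (suc m) f≈g = +-cong (sum<-cong m f≈g) (f≈g m)

  sum<-suc-first : ∀ m (f : ℕ → Carrier) → sum< R (suc m) f ≈ f 0 + sum< R m (λ i → f (suc i))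
  sum<-suc-first zero    f = trans (+-identityˡ (f 0)) (sym (+-identityʳ (f 0)))
  sum<-suc-first (suc m) f = begin
    sum< R (suc m) f + f (suc m)                    ≈⟨ +-congʳ (sum<-suc-first m f) ⟩
    (f 0 + sum< R m (λ i → f (suc i))) + f (suc m)  ≈⟨ +-assoc _ _ _ ⟩
    f 0 + sum< R (suc m) (λ i → f (suc i))          ∎

  *-distribˡ-sum< : ∀ m a (f : ℕ → Carrier) → a * sum< R m f ≈ sum< R m (λ j → a * f j)
  *-distribˡ-sum< zero    a f = zeroʳ a
  *-distribˡ-sum< (suc m) a f = trans (distribˡ a _ _) (+-congʳ (*-distribˡ-sum< m a f))

  x+y≈z⇒x≈z-y : ∀ {x y z} → x + y ≈ z → x ≈ z - y
  x+y≈z⇒x≈z-y {x} {y} x+y≈z = trans (sym (//-rightDividesʳ y x)) (+-congʳ x+y≈z)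

  sum<-telescope-down : ∀ m (f g : ℕ → Carrier) → (∀ j → j < m → f j + g (suc j) ≈ g j) →
                        sum< R m f ≈ g 0 - g m
  sum<-telescope-down m f g step = x+y≈z⇒x≈z-y (telescope m step)
    where
    telescope : ∀ i → (∀ j → j < i → f j + g (suc j) ≈ g j) → sum< R i f + g i ≈ g 0
    telescope zero    _    = +-identityˡ (g 0)
    telescope (suc i) step = begin
      (sum< R i f + f i) + g (suc i)  ≈⟨ +-assoc _ _ _ ⟩
      sum< R i f + (f i + g (suc i))  ≈⟨ +-congˡ (step i ≤-refl) ⟩
      sum< R i f + g i                ≈⟨ telescope i (λ j j<i → step j (m≤n⇒m≤1+n j<i)) ⟩
      g 0                             ∎

  sum<-telescope-up : ∀ m (f g : ℕ → Carrier) → (∀ j → f j + g j ≈ g (suc j)) →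
                      sum< R m f ≈ g m - g 0
  sum<-telescope-up m f g step = x+y≈z⇒x≈z-y (telescope m)
    where
    telescope : ∀ i → sum< R i f + g 0 ≈ g i
    telescope zero    = +-identityˡ (g 0)
    telescope (suc i) = begin
      (sum< R i f + f i) + g 0  ≈⟨ +-assoc _ _ _ ⟩
      sum< R i f + (f i + g 0)  ≈⟨ +-congˡ (+-comm _ _) ⟩
      sum< R i f + (g 0 + f i)  ≈⟨ sym (+-assoc _ _ _) ⟩
      (sum< R i f + g 0) + f i  ≈⟨ +-congʳ (telescope i) ⟩
      g i + f i                 ≈⟨ +-comm _ _ ⟩
      f i + g i                 ≈⟨ step i ⟩
      g (suc i)                 ∎

  two*x≈x+x : ∀ x → two R * x ≈ x + x
  two*x≈x+x x = trans (distribʳ x 1# 1#) (+-cong (*-identityˡ x) (*-identityˡ x))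

  [x*-1]*y≈-[x*y] : ∀ x y → (x * - 1#) * y ≈ - (x * y)
  [x*-1]*y≈-[x*y] x y = begin
    (x * - 1#) * y  ≈⟨ *-congʳ (trans (*-comm x (- 1#)) (-1*x≈-x x)) ⟩
    - x * y         ≈⟨ sym (-‿distribˡ-* x y) ⟩
    - (x * y)       ∎

  module _ (W : ℤ → Carrier) where

    W-cong : ∀ {x y} → x ≡ y → W x ≈ W y
    W-cong x≡y = reflexive (cong W x≡y)

    doubling : ∀ n → IsGenFib R n W → ∀ m → W (m +ℤ + 1) + W (m -ℤ + n) ≈ two R * W m
    doubling zero    W-rec m = begin
      W (m +ℤ + 1) + W (m -ℤ + 0)  ≈⟨ +-cong (W-rec _) (W-rec _) ⟩
      0# + 0#                      ≈⟨ +-identityˡ 0# ⟩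
      0#                           ≈⟨ sym (zeroʳ (two R)) ⟩
      two R * 0#                   ≈⟨ *-congˡ (sym (W-rec m)) ⟩
      two R * W m                  ∎
    doubling (suc p) W-rec m = begin
      W (m +ℤ + 1) + W (m -ℤ + suc p)
        ≈⟨ +-congʳ (trans (W-rec _) (sum<-suc-first p _)) ⟩
      (W (m +ℤ + 1 -ℤ + 1) + sum< R p (λ i → W (m +ℤ + 1 -ℤ + suc (suc i)))) + W (m -ℤ + suc p)
        ≈⟨ +-congʳ (+-cong (W-cong (m+1-1≡m m)) (sum<-cong p (λ i → W-cong (m+1-[2+i]≡m-[1+i] m (+ i))))) ⟩
      (W m + sum< R p (λ i → W (m -ℤ + suc i))) + W (m -ℤ + suc p)
        ≈⟨ +-assoc _ _ _ ⟩
      W m + sum< R (suc p) (λ i → W (m -ℤ + suc i))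
        ≈⟨ +-congˡ (sym (W-rec m)) ⟩
      W m + W m
        ≈⟨ sym (two*x≈x+x (W m)) ⟩
      two R * W m ∎
      where
      m+1-1≡m : ∀ m → m +ℤ + 1 -ℤ + 1 ≡ m
      m+1-1≡m = solve-∀
      m+1-[2+i]≡m-[1+i] : ∀ m i → m +ℤ + 1 -ℤ (+ 1 +ℤ (+ 1 +ℤ i)) ≡ m -ℤ (+ 1 +ℤ i)
      m+1-[2+i]≡m-[1+i] = solve-∀

    module _ (n : ℕ) (W-rec : IsGenFib R n W) where

      scaled-doubling : ∀ x m → x * W (m +ℤ + 1) + x * W (m -ℤ + n) ≈ (x * two R) * W m
      scaled-doubling x m = begin
        x * W (m +ℤ + 1) + x * W (m -ℤ + n)  ≈⟨ sym (distribˡ x _ _) ⟩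
        x * (W (m +ℤ + 1) + W (m -ℤ + n))    ≈⟨ *-congˡ (doubling n W-rec m) ⟩
        x * (two R * W m)                    ≈⟨ sym (*-assoc _ _ _) ⟩
        (x * two R) * W m                    ∎

      module _ (r : ℤ) (k : ℕ) where

        descending-powers-of-two-sum :
          sum< R (suc k) (λ j → pow R (two R) (k ∸ j) * W (r -ℤ + k -ℤ + n -ℤ + 1 +ℤ + j))
            ≈ pow R (two R) (suc k) * W (r -ℤ + k -ℤ + 1) - W r
        descending-powers-of-two-sum = begin
          sum< R (suc k) _                          ≈⟨ sum<-telescope-down (suc k) _ g step ⟩
          g 0 - g (suc k)                           ≈⟨ +-cong (*-congˡ (W-cong (a+0≡a r (+ k))))
                                                               (-‿cong g[1+k]≈Wr) ⟩
          pow R (two R) (suc k) * W (r -ℤ + k -ℤ + 1) - W r ∎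
          where
          a : ℕ → ℤ
          a j = r -ℤ + k -ℤ + 1 +ℤ + j
          g : ℕ → Carrier
          g j = pow R (two R) (suc k ∸ j) * W (a j)

          a+0≡a : ∀ r k → r -ℤ k -ℤ + 1 +ℤ + 0 ≡ r -ℤ k -ℤ + 1
          a+0≡a = solve-∀
          a[1+k]≡r : ∀ r k → r -ℤ k -ℤ + 1 +ℤ (+ 1 +ℤ k) ≡ r
          a[1+k]≡r = solve-∀
          summand-index : ∀ r k n j → r -ℤ k -ℤ n -ℤ + 1 +ℤ j ≡ (r -ℤ k -ℤ + 1 +ℤ j) -ℤ n
          summand-index = solve-∀
          a-suc : ∀ r k j → r -ℤ k -ℤ + 1 +ℤ (+ 1 +ℤ j) ≡ (r -ℤ k -ℤ + 1 +ℤ j) +ℤ + 1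
          a-suc = solve-∀

          g[1+k]≈Wr : g (suc k) ≈ W r
          g[1+k]≈Wr = begin
            pow R (two R) (k ∸ k) * W (a (suc k))  ≈⟨ *-cong (reflexive (cong (pow R (two R)) (n∸n≡0 k)))
                                                             (W-cong (a[1+k]≡r r (+ k))) ⟩
            1# * W r                               ≈⟨ *-identityˡ (W r) ⟩
            W r                                    ∎

          step : ∀ j → j < suc k → pow R (two R) (k ∸ j) * W (r -ℤ + k -ℤ + n -ℤ + 1 +ℤ + j) + g (suc j) ≈ g j
          step j (s≤s j≤k) = begin
            Q * W (r -ℤ + k -ℤ + n -ℤ + 1 +ℤ + j) + Q * W (a (suc j))
              ≈⟨ +-cong (*-congˡ (W-cong (summand-index r (+ k) (+ n) (+ j))))
                        (*-congˡ (W-cong (a-suc r (+ k) (+ j)))) ⟩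
            Q * W (a j -ℤ + n) + Q * W (a j +ℤ + 1)  ≈⟨ +-comm _ _ ⟩
            Q * W (a j +ℤ + 1) + Q * W (a j -ℤ + n)  ≈⟨ scaled-doubling Q (a j) ⟩
            pow R (two R) (suc (k ∸ j)) * W (a j)    ≈⟨ reflexive (cong (λ e → pow R (two R) e * W (a j))
                                                                    (≡-sym (+-∸-assoc 1 j≤k))) ⟩
            g j                                      ∎
            where
            Q = pow R (two R) (k ∸ j)

        alternating-sum :
          two R * sum< R (suc k) (λ j → pow R (- 1#) j * W (r -ℤ + n *ℤ + k -ℤ + k -ℤ + 1 +ℤ + (n Data.Nat.+ 1) *ℤ + j))
            ≈ pow R (- 1#) k * W r + W (r -ℤ + (k Data.Nat.+ 1) *ℤ + (n Data.Nat.+ 1))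
        alternating-sum = begin
          two R * sum< R (suc k) f                     ≈⟨ *-distribˡ-sum< (suc k) (two R) f ⟩
          sum< R (suc k) (λ j → two R * f j)           ≈⟨ sum<-telescope-down (suc k) _ g step ⟩
          g 0 - g (suc k)                              ≈⟨ +-cong g0≈ (-‿cong g[1+k]≈-Wr) ⟩
          W (r -ℤ + (k Data.Nat.+ 1) *ℤ + (n Data.Nat.+ 1)) - - (pow R (- 1#) k * W r)
                                                       ≈⟨ +-congˡ (-‿involutive _) ⟩
          W (r -ℤ + (k Data.Nat.+ 1) *ℤ + (n Data.Nat.+ 1)) + pow R (- 1#) k * W r
                                                       ≈⟨ +-comm _ _ ⟩
          pow R (- 1#) k * W r + W (r -ℤ + (k Data.Nat.+ 1) *ℤ + (n Data.Nat.+ 1)) ∎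
          where
          f : ℕ → Carrier
          f j = pow R (- 1#) j * W (r -ℤ + n *ℤ + k -ℤ + k -ℤ + 1 +ℤ + (n Data.Nat.+ 1) *ℤ + j)
          N : ℤ
          N = + n +ℤ + 1
          b : ℕ → ℤ
          b j = r -ℤ N *ℤ (+ k +ℤ + 1) +ℤ N *ℤ + j
          g : ℕ → Carrier
          g j = pow R (- 1#) j * W (b j)
          m : ℕ → ℤ
          m j = r -ℤ + n *ℤ + k -ℤ + k -ℤ + 1 +ℤ N *ℤ + j

          b0 : ∀ r n k → r -ℤ (n +ℤ + 1) *ℤ (k +ℤ + 1) +ℤ (n +ℤ + 1) *ℤ + 0 ≡ r -ℤ (k +ℤ + 1) *ℤ (n +ℤ + 1)
          b0 = solve-∀
          b[1+k]≡r : ∀ r n k → r -ℤ (n +ℤ + 1) *ℤ (k +ℤ + 1) +ℤ (n +ℤ + 1) *ℤ (+ 1 +ℤ k) ≡ r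
          b[1+k]≡r = solve-∀
          m-n≡b : ∀ r n k j → (r -ℤ n *ℤ k -ℤ k -ℤ + 1 +ℤ (n +ℤ + 1) *ℤ j) -ℤ n
                                ≡ r -ℤ (n +ℤ + 1) *ℤ (k +ℤ + 1) +ℤ (n +ℤ + 1) *ℤ j
          m-n≡b = solve-∀
          m+1≡b-suc : ∀ r n k j → (r -ℤ n *ℤ k -ℤ k -ℤ + 1 +ℤ (n +ℤ + 1) *ℤ j) +ℤ + 1
                                    ≡ r -ℤ (n +ℤ + 1) *ℤ (k +ℤ + 1) +ℤ (n +ℤ + 1) *ℤ (+ 1 +ℤ j)
          m+1≡b-suc = solve-∀

          g0≈ : g 0 ≈ W (r -ℤ + (k Data.Nat.+ 1) *ℤ + (n Data.Nat.+ 1))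
          g0≈ = trans (*-identityˡ _) (W-cong (Eq.trans (b0 r (+ n) (+ k))
                  (cong₂ (λ x y → r -ℤ x *ℤ y) (≡-sym (pos-+ k 1)) (≡-sym (pos-+ n 1)))))

          g[1+k]≈-Wr : g (suc k) ≈ - (pow R (- 1#) k * W r)
          g[1+k]≈-Wr = trans ([x*-1]*y≈-[x*y] _ _) (-‿cong (*-congˡ (W-cong (b[1+k]≡r r (+ n) (+ k)))))

          step : ∀ j → j < suc k → two R * f j + g (suc j) ≈ g j
          step j _ = begin
            two R * (ε * W (r -ℤ + n *ℤ + k -ℤ + k -ℤ + 1 +ℤ + (n Data.Nat.+ 1) *ℤ + j)) + (ε * - 1#) * W (b (suc j))
              ≈⟨ +-cong (*-congˡ (*-congˡ (W-cong summand-index≡m))) ([x*-1]*y≈-[x*y] ε _) ⟩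
            two R * (ε * W (m j)) - ε * W (b (suc j))
              ≈⟨ +-congʳ (trans (x∙yz≈yx∙z (two R) ε _) (sym (scaled-doubling ε (m j)))) ⟩
            (ε * W (m j +ℤ + 1) + ε * W (m j -ℤ + n)) - ε * W (b (suc j))
              ≈⟨ +-cong (+-cong (*-congˡ (W-cong (m+1≡b-suc r (+ n) (+ k) (+ j))))
                                (*-congˡ (W-cong (m-n≡b r (+ n) (+ k) (+ j)))))
                        refl ⟩
            (ε * W (b (suc j)) + g j) - ε * W (b (suc j))
              ≈⟨ xyx⁻¹≈y _ _ ⟩
            g j ∎
            where
            ε = pow R (- 1#) j
            summand-index≡m : r -ℤ + n *ℤ + k -ℤ + k -ℤ + 1 +ℤ + (n Data.Nat.+ 1) *ℤ + j ≡ m j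
            summand-index≡m = cong (λ t → r -ℤ + n *ℤ + k -ℤ + k -ℤ + 1 +ℤ t *ℤ + j) (pos-+ n 1)

        ascending-powers-of-two-sum :
          sum< R (suc k) (λ j → pow R (two R) j * W (r -ℤ + n *ℤ + k +ℤ + 1 +ℤ + n *ℤ + j))
            ≈ pow R (two R) (suc k) * W r - W (r -ℤ + (k Data.Nat.+ 1) *ℤ + n)
        ascending-powers-of-two-sum = begin
          sum< R (suc k) _   ≈⟨ sum<-telescope-up (suc k) _ h step ⟩
          h (suc k) - h 0    ≈⟨ +-cong (*-congˡ (W-cong (c[1+k]≡r r (+ n) (+ k)))) (-‿cong h0≈) ⟩
          pow R (two R) (suc k) * W r - W (r -ℤ + (k Data.Nat.+ 1) *ℤ + n) ∎
          where
          c : ℕ → ℤ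
          c j = r -ℤ + n *ℤ (+ k +ℤ + 1) +ℤ + n *ℤ + j
          h : ℕ → Carrier
          h j = pow R (two R) j * W (c j)
          m : ℕ → ℤ
          m j = r -ℤ + n *ℤ + k +ℤ + n *ℤ + j

          c0 : ∀ r n k → r -ℤ n *ℤ (k +ℤ + 1) +ℤ n *ℤ + 0 ≡ r -ℤ (k +ℤ + 1) *ℤ n
          c0 = solve-∀
          c[1+k]≡r : ∀ r n k → r -ℤ n *ℤ (k +ℤ + 1) +ℤ n *ℤ (+ 1 +ℤ k) ≡ r
          c[1+k]≡r = solve-∀
          summand-index : ∀ r n k j → r -ℤ n *ℤ k +ℤ + 1 +ℤ n *ℤ j ≡ (r -ℤ n *ℤ k +ℤ n *ℤ j) +ℤ + 1
          summand-index = solve-∀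
          c≡m-n : ∀ r n k j → r -ℤ n *ℤ (k +ℤ + 1) +ℤ n *ℤ j ≡ (r -ℤ n *ℤ k +ℤ n *ℤ j) -ℤ n
          c≡m-n = solve-∀
          c-suc≡m : ∀ r n k j → r -ℤ n *ℤ (k +ℤ + 1) +ℤ n *ℤ (+ 1 +ℤ j) ≡ r -ℤ n *ℤ k +ℤ n *ℤ j
          c-suc≡m = solve-∀

          h0≈ : h 0 ≈ W (r -ℤ + (k Data.Nat.+ 1) *ℤ + n)
          h0≈ = trans (*-identityˡ _) (W-cong (Eq.trans (c0 r (+ n) (+ k))
                  (cong (λ x → r -ℤ x *ℤ + n) (≡-sym (pos-+ k 1)))))

          step : ∀ j → pow R (two R) j * W (r -ℤ + n *ℤ + k +ℤ + 1 +ℤ + n *ℤ + j) + h j ≈ h (suc j)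
          step j = begin
            Q * W (r -ℤ + n *ℤ + k +ℤ + 1 +ℤ + n *ℤ + j) + Q * W (c j)
              ≈⟨ +-cong (*-congˡ (W-cong (summand-index r (+ n) (+ k) (+ j))))
                        (*-congˡ (W-cong (c≡m-n r (+ n) (+ k) (+ j)))) ⟩
            Q * W (m j +ℤ + 1) + Q * W (m j -ℤ + n)  ≈⟨ scaled-doubling Q (m j) ⟩
            (Q * two R) * W (m j)                    ≈⟨ *-congˡ (W-cong (≡-sym (c-suc≡m r (+ n) (+ k) (+ j)))) ⟩
            h (suc j)                                ∎
            where
            Q = pow R (two R) j

theorem3 : ∀ {c ℓ} (R : CommutativeRing c ℓ) (n : ℕ) → 2 ≤ n →
    (W : ℤ → CommutativeRing.Carrier R) → IsGenFib R n W →
    ∀ (r : ℤ) (k : ℕ) →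
      let open CommutativeRing R in
      (sum< R (suc k) (λ j → pow R (two R) (k Data.Nat.∸ j) * W (r -ℤ + k -ℤ + n -ℤ + 1 +ℤ + j))
        ≈ pow R (two R) (suc k) * W (r -ℤ + k -ℤ + 1) - W r)
      × (two R * sum< R (suc k) (λ j → pow R (- 1#) j * W (r -ℤ + n *ℤ + k -ℤ + k -ℤ + 1 +ℤ + (n Data.Nat.+ 1) *ℤ + j))
        ≈ pow R (- 1#) k * W r + W (r -ℤ + (k Data.Nat.+ 1) *ℤ + (n Data.Nat.+ 1)))
      × (sum< R (suc k) (λ j → pow R (two R) j * W (r -ℤ + n *ℤ + k +ℤ + 1 +ℤ + n *ℤ + j))
        ≈ pow R (two R) (suc k) * W r - W (r -ℤ + (k Data.Nat.+ 1) *ℤ + n))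
-- The identities hold for every n ≥ 0.
theorem3 R n _ W W-rec r k =
    descending-powers-of-two-sum R W n W-rec r k
  , alternating-sum R W n W-rec r k
  , ascending-powers-of-two-sum R W n W-rec r k
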